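{- Let $n\ge 2$ be even, let $p_1,\dots,p_l$ be distinct primes each of which is a $\varphi$-divisor of $n$ of degree $k_i$ (with $p_i^{k_i}\ge 3$), let $2\le m\le\min(p_1^{k_1}-1,\dots,p_l^{k_l}-1)$, let $c=p_1^{n_1}\cdots p_l^{n_l}$ with natural $n_1,\dots,n_l$, and let $b$ be a nonnegative integer. Then the equation $\sum_{i=1}^m x_i^n=bc^n$ is solvable in nonnegative integers if and only if the equation $\sum_{i=1}^m x_i^n=b$ is solvable in nonnegative integers.
   Context: $\varphi$ is Euler's totient function. For an even natural number $n$, a prime $q$ is a $\varphi$-divisor of $n$ if there is a natural $k$ with $q^k\ge3$ and $\varphi(q^k)\mid n$; the largest such $k$ is its degree. -}

module Defs where

open import Data.Nat using (ℕ; zero; suc; _+_; _*_; _∸_; _^_; _≤_; _≥_)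
open import Data.Nat.Divisibility using (_∣_)
open import Data.Nat.Primality using (Prime)
open import Data.Nat.Coprimality using (coprime?)
open import Data.List using (List; length; filter; upTo; map)
open import Data.Fin using (Fin; zero; suc)

φ : ℕ → ℕ
φ n = length (filter (λ k → coprime? k n) (map suc (upTo n)))

IsφDivisorOfDegree : ℕ → ℕ → ℕ → Set
IsφDivisorOfDegree n q k =
  Prime q × (q ^ k ≥ 3) × (φ (q ^ k) ∣ n) ×
  (∀ j → q ^ j ≥ 3 → φ (q ^ j) ∣ n → j ≤ k)
  where open import Data.Product using (_×_)

sumFin : ∀ m → (Fin m → ℕ) → ℕ
sumFin zero    f = 0
sumFin (suc m) f = f zero + sumFin m (λ i → f (suc i))

prodFin : ∀ m → (Fin m → ℕ) → ℕ
prodFin zero    f = 1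
prodFin (suc m) f = f zero * prodFin m (λ i → f (suc i))

SolvableSumPow : (m n t : ℕ) → Set
SolvableSumPow m n t = Σ (Fin m → ℕ) (λ x → sumFin m (λ i → x i ^ n) ≡ t)
  where open import Data.Product using (Σ)
        open import Relation.Binary.PropositionalEquality using (_≡_)

-- Fix one prime p of c with φ-divisor degree k and put N = p ^ k. Euler's theorem gives
-- z ^ n ≡ 1 (mod N) when p ∤ z, because φ N ∣ n; when p ∣ z we get z ^ n ≡ 0 (mod N),
-- because k ≤ φ N ≤ n. Hence a sum of m n-th powers equal to B * p ^ n is congruent mod N
-- to the number of its terms prime to p, a number at most m < N that must therefore vanish:
-- every term is a multiple of p, and dividing all of them by p gives a solution for B.
-- Removing the primes of c one at a time gives one implication; multiplying a solution
-- by c gives the other.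

module Submission where

open import Defs
open import Data.Nat using (ℕ; _^_; _*_; _∸_; _≤_; _≥_; zero; suc)
open import Data.Nat.Divisibility using (_∣_)
open import Data.Fin using (Fin)
open import Data.Product using (_×_)
open import Function.Definitions using (Injective)
open import Relation.Binary.PropositionalEquality using (_≡_)
open import Function.Bundles using (_⇔_)

open import Data.Empty using (⊥-elim)
open import Data.Fin using (toℕ; fromℕ<)
import Data.Fin as Fin
open import Data.Fin.Permutation using (Permutation; permutation; _⟨$⟩ʳ_)
open import Data.Fin.Properties using (toℕ-injective; toℕ-fromℕ<; toℕ<n)
open import Data.List using (length; filter; map; applyUpTo)
open import Data.Nat using (_+_; _<_; NonZero; >-nonZero; z≤n; s≤s; pred)
open import Data.Nat.Base using (nonTrivial⇒≢1; nonTrivial⇒n>1)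
open import Data.Nat.Coprimality using (Coprime; coprime?; coprime-divisor; coprime-Bézout; 1-coprimeTo)
import Data.Nat.Coprimality as Coprime
open import Data.Nat.Divisibility
open import Data.Nat.DivMod
  using (_%_; _/_; m%n<n; m%n%n≡m%n; m<n⇒m%n≡m; %-distribˡ-+; %-distribˡ-*; m≡m%n+[m/n]*n;
         [m+kn]%n≡m%n; %-remove-+ʳ)
open import Data.Nat.GCD using (module Bézout)
open import Data.Nat.Primality using (Prime; prime⇒irreducible; prime⇒nonTrivial; prime⇒nonZero)
open import Data.Nat.Properties
open import Data.Nat.Solver using (module +-*-Solver)
open import Algebra.Properties.CommutativeMonoid.Sum *-1-commutativeMonoid
  using () renaming (sum to product; sum-permute to product-permute)
open import Data.Product using (_,_; proj₁; proj₂; ∃)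
open import Data.Sum using (inj₁; inj₂)
open import Function using (_∘_; id)
open import Function.Bundles using (Equivalence; mk⇔)
open import Function.Related.TypeIsomorphisms using (¬-cong-⇔)
open import Relation.Binary.PropositionalEquality using (refl; sym; trans; cong; cong₂; subst; module ≡-Reasoning)
open import Relation.Nullary using (Dec; yes; no; ¬_; ¬?; contradiction)
open import Relation.Nullary.Decidable using (decidable-stable)
open import Relation.Unary using (Decidable)

𝟙 : {P : Set} → Dec P → ℕ
𝟙 (yes _) = 1
𝟙 (no _)  = 0

𝟙-cong : {P Q : Set} (P? : Dec P) (Q? : Dec Q) → P ⇔ Q → 𝟙 P? ≡ 𝟙 Q?
𝟙-cong (yes _) (yes _) _   = refl
𝟙-cong (yes p) (no ¬q) P⇔Q = contradiction (Equivalence.to P⇔Q p) ¬q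
𝟙-cong (no ¬p) (yes q) P⇔Q = contradiction (Equivalence.from P⇔Q q) ¬p
𝟙-cong (no _)  (no _)  _   = refl

𝟙≤1 : {P : Set} (P? : Dec P) → 𝟙 P? ≤ 1
𝟙≤1 (yes _) = ≤-refl
𝟙≤1 (no _)  = z≤n

𝟙≡0⇒¬ : {P : Set} (P? : Dec P) → 𝟙 P? ≡ 0 → ¬ P
𝟙≡0⇒¬ (no ¬p) _ = ¬p

sumFin-cong : ∀ m {f g : Fin m → ℕ} → (∀ i → f i ≡ g i) → sumFin m f ≡ sumFin m g
sumFin-cong zero    f≗g = refl
sumFin-cong (suc m) f≗g = cong₂ _+_ (f≗g Fin.zero) (sumFin-cong m (f≗g ∘ Fin.suc))

sumFin-*ʳ : ∀ m (f : Fin m → ℕ) c → sumFin m (λ i → f i * c) ≡ sumFin m f * c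
sumFin-*ʳ zero    f c = refl
sumFin-*ʳ (suc m) f c = begin
  f Fin.zero * c + sumFin m (λ i → f (Fin.suc i) * c) ≡⟨ cong (f Fin.zero * c +_) (sumFin-*ʳ m (f ∘ Fin.suc) c) ⟩
  f Fin.zero * c + sumFin m (f ∘ Fin.suc) * c         ≡⟨ *-distribʳ-+ c (f Fin.zero) _ ⟨
  sumFin (suc m) f * c                                 ∎
  where open ≡-Reasoning

sumFin≡0⇒≡0 : ∀ m (f : Fin m → ℕ) → sumFin m f ≡ 0 → ∀ i → f i ≡ 0
sumFin≡0⇒≡0 (suc m) f Σ≡0 Fin.zero    = m+n≡0⇒m≡0 (f Fin.zero) Σ≡0
sumFin≡0⇒≡0 (suc m) f Σ≡0 (Fin.suc i) = sumFin≡0⇒≡0 m (f ∘ Fin.suc) (m+n≡0⇒n≡0 (f Fin.zero) Σ≡0) i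

sumFin-≤1 : ∀ m (f : Fin m → ℕ) → (∀ i → f i ≤ 1) → sumFin m f ≤ m
sumFin-≤1 zero    f f≤1 = z≤n
sumFin-≤1 (suc m) f f≤1 = +-mono-≤ (f≤1 Fin.zero) (sumFin-≤1 m (f ∘ Fin.suc) (f≤1 ∘ Fin.suc))

sumTo : ℕ → (ℕ → ℕ) → ℕ
sumTo n f = sumFin n (f ∘ toℕ)

sumTo-cong : ∀ n {f g : ℕ → ℕ} → (∀ {a} → a < n → f a ≡ g a) → sumTo n f ≡ sumTo n g
sumTo-cong zero    f≗g = refl
sumTo-cong (suc n) f≗g = cong₂ _+_ (f≗g (s≤s z≤n)) (sumTo-cong n (f≗g ∘ s≤s))

sumTo-const : ∀ n c → sumTo n (λ _ → c) ≡ n * c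
sumTo-const zero    c = refl
sumTo-const (suc n) c = cong (c +_) (sumTo-const n c)

sumTo-+ : ∀ a b f → sumTo (a + b) f ≡ sumTo a f + sumTo b (λ j → f (a + j))
sumTo-+ zero    b f = refl
sumTo-+ (suc a) b f = trans (cong (f 0 +_) (sumTo-+ a b (f ∘ suc))) (sym (+-assoc (f 0) _ _))

sumTo-suc : ∀ n f → sumTo (suc n) f ≡ sumTo n f + f n
sumTo-suc zero    f = +-identityʳ (f 0)
sumTo-suc (suc n) f = trans (cong (f 0 +_) (sumTo-suc n (f ∘ suc))) (sym (+-assoc (f 0) _ _))

sumTo-rotate : ∀ n f → f 0 ≡ f n → sumTo n (f ∘ suc) ≡ sumTo n f
sumTo-rotate zero    f _      = refl
sumTo-rotate (suc n) f f0≡fn = begin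
  sumTo (suc n) (f ∘ suc)     ≡⟨ sumTo-suc n (f ∘ suc) ⟩
  sumTo n (f ∘ suc) + f (suc n) ≡⟨ +-comm _ (f (suc n)) ⟩
  f (suc n) + sumTo n (f ∘ suc) ≡⟨ cong (_+ sumTo n (f ∘ suc)) f0≡fn ⟨
  sumTo (suc n) f             ∎
  where open ≡-Reasoning

sumTo-periodic : ∀ p M f → (∀ a → f (p + a) ≡ f a) → sumTo (M * p) f ≡ M * sumTo p f
sumTo-periodic p zero    f per = refl
sumTo-periodic p (suc M) f per = begin
  sumTo (p + M * p) f                       ≡⟨ sumTo-+ p (M * p) f ⟩
  sumTo p f + sumTo (M * p) (λ j → f (p + j)) ≡⟨ cong (sumTo p f +_) (sumTo-cong (M * p) (λ {a} _ → per a)) ⟩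
  sumTo p f + sumTo (M * p) f               ≡⟨ cong (sumTo p f +_) (sumTo-periodic p M f per) ⟩
  sumTo p f + M * sumTo p f                 ∎
  where open ≡-Reasoning

length-filter-map-applyUpTo : ∀ {P : ℕ → Set} (P? : Decidable P) (g f : ℕ → ℕ) n →
  length (filter P? (map g (applyUpTo f n))) ≡ sumTo n (λ a → 𝟙 (P? (g (f a))))
length-filter-map-applyUpTo P? g f zero = refl
length-filter-map-applyUpTo P? g f (suc n) with P? (g (f 0))
... | yes _ = cong suc (length-filter-map-applyUpTo P? g (f ∘ suc) n)
... | no _  = length-filter-map-applyUpTo P? g (f ∘ suc) n

prodFin≡product : ∀ n (f : Fin n → ℕ) → prodFin n f ≡ product f
prodFin≡product zero    f = refl
prodFin≡product (suc n) f = cong (f Fin.zero *_) (prodFin≡product n (f ∘ Fin.suc))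

prodFin-permute : ∀ n (f : Fin n → ℕ) (π : Permutation n n) → prodFin n f ≡ prodFin n (λ i → f (π ⟨$⟩ʳ i))
prodFin-permute n f π = begin
  prodFin n f                    ≡⟨ prodFin≡product n f ⟩
  product f                      ≡⟨ product-permute f π ⟩
  product (λ i → f (π ⟨$⟩ʳ i))   ≡⟨ prodFin≡product n _ ⟨
  prodFin n (λ i → f (π ⟨$⟩ʳ i)) ∎
  where open ≡-Reasoning

prodFin-^-* : ∀ x n (c f : Fin n → ℕ) → prodFin n (λ i → x ^ c i * f i) ≡ x ^ sumFin n c * prodFin n f
prodFin-^-* x zero    c f = refl
prodFin-^-* x (suc n) c f = begin
  x ^ c₀ * f₀ * prodFin n (λ i → x ^ c (Fin.suc i) * f (Fin.suc i))
    ≡⟨ cong (x ^ c₀ * f₀ *_) (prodFin-^-* x n (c ∘ Fin.suc) (f ∘ Fin.suc)) ⟩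
  x ^ c₀ * f₀ * (x ^ Σc * Πf)
    ≡⟨ [m*n]*[o*p]≡[m*o]*[n*p] (x ^ c₀) f₀ (x ^ Σc) Πf ⟩
  x ^ c₀ * x ^ Σc * (f₀ * Πf)
    ≡⟨ cong (_* (f₀ * Πf)) (^-distribˡ-+-* x c₀ Σc) ⟨
  x ^ (c₀ + Σc) * (f₀ * Πf)
    ∎
  where
  open ≡-Reasoning
  c₀ = c Fin.zero
  f₀ = f Fin.zero
  Σc = sumFin n (c ∘ Fin.suc)
  Πf = prodFin n (f ∘ Fin.suc)

^-distribʳ-* : ∀ a b n → (a * b) ^ n ≡ a ^ n * b ^ n
^-distribʳ-* a b zero    = refl
^-distribʳ-* a b (suc n) = begin
  a * b * (a * b) ^ n      ≡⟨ cong (a * b *_) (^-distribʳ-* a b n) ⟩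
  a * b * (a ^ n * b ^ n)  ≡⟨ [m*n]*[o*p]≡[m*o]*[n*p] a b (a ^ n) (b ^ n) ⟩
  a * a ^ n * (b * b ^ n)  ∎
  where open ≡-Reasoning

∣⇒^∣^ : ∀ {a b} → a ∣ b → ∀ n → a ^ n ∣ b ^ n
∣⇒^∣^ a∣b zero    = ∣-refl
∣⇒^∣^ a∣b (suc n) = *-pres-∣ a∣b (∣⇒^∣^ a∣b n)

^-monoʳ-∣ : ∀ p {k n} → k ≤ n → p ^ k ∣ p ^ n
^-monoʳ-∣ p {k} {n} k≤n = divides (p ^ (n ∸ k)) (begin
  p ^ n                 ≡⟨ cong (p ^_) (m+[n∸m]≡n k≤n) ⟨
  p ^ (k + (n ∸ k))     ≡⟨ ^-distribˡ-+-* p k (n ∸ k) ⟩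
  p ^ k * p ^ (n ∸ k)   ≡⟨ *-comm (p ^ k) _ ⟩
  p ^ (n ∸ k) * p ^ k   ∎)
  where open ≡-Reasoning

coprime[0,n]⇔coprime[n,n] : ∀ {n} → Coprime 0 n ⇔ Coprime n n
coprime[0,n]⇔coprime[n,n] =
  mk⇔ (λ 0⊥n {_} (d∣n , _) → 0⊥n (_ ∣0 , d∣n)) (λ n⊥n {_} (_ , d∣n) → n⊥n (d∣n , d∣n))

coprime-* : ∀ {a b n} → Coprime a n → Coprime b n → Coprime (a * b) n
coprime-* {a} {b} {n} a⊥n b⊥n {d} (d∣ab , d∣n) = b⊥n (coprime-divisor d⊥a d∣ab , d∣n)
  where
  d⊥a : Coprime d a
  d⊥a (e∣d , e∣a) = a⊥n (e∣a , ∣-trans e∣d d∣n)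

coprime-^ : ∀ {a n} → Coprime a n → ∀ k → Coprime (a ^ k) n
coprime-^ a⊥n zero    = 1-coprimeTo _
coprime-^ a⊥n (suc k) = coprime-* a⊥n (coprime-^ a⊥n k)

prime∤⇒coprime : ∀ {p a} → Prime p → ¬ p ∣ a → Coprime a p
prime∤⇒coprime pr p∤a (d∣a , d∣p) with prime⇒irreducible pr d∣p
... | inj₁ d≡1 = d≡1
... | inj₂ refl = contradiction d∣a p∤a

coprime[a,p^[1+j]]⇔∤ : ∀ {p a} → Prime p → ∀ j → Coprime a (p ^ suc j) ⇔ (¬ p ∣ a)
coprime[a,p^[1+j]]⇔∤ {p} {a} pr j = mk⇔ coprime⇒∤ ∤⇒coprime
  where
  coprime⇒∤ : Coprime a (p ^ suc j) → ¬ p ∣ a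
  coprime⇒∤ a⊥N p∣a = nonTrivial⇒≢1 {{prime⇒nonTrivial pr}} (a⊥N (p∣a , m∣m*n (p ^ j)))
  ∤⇒coprime : ¬ p ∣ a → Coprime a (p ^ suc j)
  ∤⇒coprime p∤a = Coprime.sym (coprime-^ (Coprime.sym (prime∤⇒coprime pr p∤a)) (suc j))

¬coprime[a,p^[1+j]]⇒∣ : ∀ {p a} → Prime p → ∀ j → ¬ Coprime a (p ^ suc j) → p ∣ a
¬coprime[a,p^[1+j]]⇒∣ {p} {a} pr j ¬a⊥N =
  decidable-stable (p ∣? a) (¬a⊥N ∘ Equivalence.from (coprime[a,p^[1+j]]⇔∤ pr j))

prodFin-coprime : ∀ {N} n (f : Fin n → ℕ) → (∀ i → Coprime (f i) N) → Coprime (prodFin n f) N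
prodFin-coprime zero    f f⊥N = 1-coprimeTo _
prodFin-coprime (suc n) f f⊥N = coprime-* (f⊥N Fin.zero) (prodFin-coprime n (f ∘ Fin.suc) (f⊥N ∘ Fin.suc))

coprime-*ˡ⇔ : ∀ {x a N} → Coprime x N → Coprime (x * a) N ⇔ Coprime a N
coprime-*ˡ⇔ {x} {a} {N} x⊥N = mk⇔ xa⊥N⇒a⊥N (coprime-* x⊥N)
  where
  xa⊥N⇒a⊥N : Coprime (x * a) N → Coprime a N
  xa⊥N⇒a⊥N xa⊥N (d∣a , d∣N) = xa⊥N (∣n⇒∣m*n x d∣a , d∣N)

coprime-%⇔ : ∀ {a N} .{{_ : NonZero N}} → Coprime (a % N) N ⇔ Coprime a N
coprime-%⇔ {a} {N} = mk⇔ r⊥N⇒a⊥N a⊥N⇒r⊥N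
  where
  r⊥N⇒a⊥N : Coprime (a % N) N → Coprime a N
  r⊥N⇒a⊥N r⊥N (d∣a , d∣N) = r⊥N (%-presˡ-∣ d∣a d∣N , d∣N)
  a⊥N⇒r⊥N : Coprime a N → Coprime (a % N) N
  a⊥N⇒r⊥N a⊥N (d∣r , d∣N) = a⊥N (∣n∣m%n⇒∣m d∣N d∣r , d∣N)

-- Euler's totient

-- φ counts 1, …, N while residues run over 0, …, N - 1; 0 and N are coprime to N alike.
φ≡count-coprime : ∀ N → φ N ≡ sumTo N (λ a → 𝟙 (coprime? a N))
φ≡count-coprime N = begin
  φ N                                      ≡⟨ length-filter-map-applyUpTo (λ a → coprime? a N) suc id N ⟩
  sumTo N (λ a → 𝟙 (coprime? (suc a) N))  ≡⟨ sumTo-rotate N (λ a → 𝟙 (coprime? a N)) 0∼N ⟩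
  sumTo N (λ a → 𝟙 (coprime? a N))        ∎
  where
  open ≡-Reasoning
  0∼N : 𝟙 (coprime? 0 N) ≡ 𝟙 (coprime? N N)
  0∼N = 𝟙-cong (coprime? 0 N) (coprime? N N) coprime[0,n]⇔coprime[n,n]

count-∤-below-prime : ∀ {p} → Prime p → sumTo p (λ a → 𝟙 (¬? (p ∣? a))) ≡ p ∸ 1
count-∤-below-prime {suc q} pr with suc q ∣? 0
... | no p∤0 = contradiction (_ ∣0) p∤0
... | yes _  = begin
  sumTo q (λ a → 𝟙 (¬? (suc q ∣? suc a))) ≡⟨ sumTo-cong q (λ a<q → 𝟙-¬∣ (>⇒∤ (s≤s a<q))) ⟩
  sumTo q (λ _ → 1)                         ≡⟨ sumTo-const q 1 ⟩
  q * 1                                     ≡⟨ *-identityʳ q ⟩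
  q                                         ∎
  where
  open ≡-Reasoning
  𝟙-¬∣ : ∀ {a} → ¬ suc q ∣ a → 𝟙 (¬? (suc q ∣? a)) ≡ 1
  𝟙-¬∣ {a} p∤a with suc q ∣? a
  ... | yes p∣a = contradiction p∣a p∤a
  ... | no _    = refl

φ[p^[1+j]]≡p^j*[p∸1] : ∀ {p} → Prime p → ∀ j → φ (p ^ suc j) ≡ p ^ j * (p ∸ 1)
φ[p^[1+j]]≡p^j*[p∸1] {p} pr j = begin
  φ N                                    ≡⟨ φ≡count-coprime N ⟩
  sumTo N (λ a → 𝟙 (coprime? a N))      ≡⟨ sumTo-cong N (λ {a} _ → coprime≡∤ a) ⟩
  sumTo N ∤p                             ≡⟨ cong (λ k → sumTo k ∤p) (*-comm p (p ^ j)) ⟩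
  sumTo (p ^ j * p) ∤p                   ≡⟨ sumTo-periodic p (p ^ j) ∤p ∤p-periodic ⟩
  p ^ j * sumTo p ∤p                     ≡⟨ cong (p ^ j *_) (count-∤-below-prime pr) ⟩
  p ^ j * (p ∸ 1)                        ∎
  where
  open ≡-Reasoning
  N = p ^ suc j
  ∤p : ℕ → ℕ
  ∤p a = 𝟙 (¬? (p ∣? a))
  coprime≡∤ : ∀ a → 𝟙 (coprime? a N) ≡ ∤p a
  coprime≡∤ a = 𝟙-cong (coprime? a N) (¬? (p ∣? a)) (coprime[a,p^[1+j]]⇔∤ pr j)
  ∤p-periodic : ∀ a → ∤p (p + a) ≡ ∤p a
  ∤p-periodic a = 𝟙-cong (¬? (p ∣? (p + a))) (¬? (p ∣? a))
    (¬-cong-⇔ (mk⇔ (λ p∣p+a → ∣m+n∣m⇒∣n p∣p+a ∣-refl) (∣m∣n⇒∣m+n ∣-refl)))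

n<m^n : ∀ {m} → 2 ≤ m → ∀ n → n < m ^ n
n<m^n {m@(suc _)} m≥2 zero    = s≤s z≤n
n<m^n {m@(suc _)} m≥2 (suc n) = begin-strict
  suc n             ≤⟨ n<m^n m≥2 n ⟩
  m ^ n             <⟨ m<m+n (m ^ n) (m^n>0 m n) ⟩
  m ^ n + m ^ n     ≡⟨ cong (m ^ n +_) (+-identityʳ (m ^ n)) ⟨
  2 * m ^ n         ≤⟨ *-monoˡ-≤ (m ^ n) m≥2 ⟩
  m * m ^ n         ∎
  where open ≤-Reasoning

k≤φ[p^k] : ∀ {p} → Prime p → ∀ k → k ≤ φ (p ^ k)
k≤φ[p^k] pr zero    = z≤n
k≤φ[p^k] {p} pr (suc j) = begin
  suc j             ≤⟨ n<m^n p≥2 j ⟩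
  p ^ j             ≡⟨ *-identityʳ (p ^ j) ⟨
  p ^ j * 1         ≤⟨ *-monoʳ-≤ (p ^ j) (∸-monoˡ-≤ 1 p≥2) ⟩
  p ^ j * (p ∸ 1)   ≡⟨ φ[p^[1+j]]≡p^j*[p∸1] pr j ⟨
  φ (p ^ suc j)     ∎
  where
  open ≤-Reasoning
  p≥2 : 2 ≤ p
  p≥2 = nonTrivial⇒n>1 p {{prime⇒nonTrivial pr}}

infix 4 _≡_mod_
_≡_mod_ : ℕ → ℕ → (N : ℕ) → .{{NonZero N}} → Set
_≡_mod_ a b N = a % N ≡ b % N

module _ {N : ℕ} .{{_ : NonZero N}} where

  +-cong-mod : ∀ {a a′ b b′} → a ≡ a′ mod N → b ≡ b′ mod N → a + b ≡ a′ + b′ mod N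
  +-cong-mod {a} {a′} {b} {b′} a≡a′ b≡b′ = begin
    (a + b) % N                ≡⟨ %-distribˡ-+ a b N ⟩
    (a % N + b % N) % N        ≡⟨ cong₂ (λ u v → (u + v) % N) a≡a′ b≡b′ ⟩
    (a′ % N + b′ % N) % N      ≡⟨ %-distribˡ-+ a′ b′ N ⟨
    (a′ + b′) % N              ∎
    where open ≡-Reasoning

  *-cong-mod : ∀ {a a′ b b′} → a ≡ a′ mod N → b ≡ b′ mod N → a * b ≡ a′ * b′ mod N
  *-cong-mod {a} {a′} {b} {b′} a≡a′ b≡b′ = begin
    (a * b) % N                ≡⟨ %-distribˡ-* a b N ⟩
    (a % N * (b % N)) % N      ≡⟨ cong₂ (λ u v → (u * v) % N) a≡a′ b≡b′ ⟩
    (a′ % N * (b′ % N)) % N    ≡⟨ %-distribˡ-* a′ b′ N ⟨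
    (a′ * b′) % N              ∎
    where open ≡-Reasoning

  ^-congˡ-mod : ∀ {a b} → a ≡ b mod N → ∀ k → a ^ k ≡ b ^ k mod N
  ^-congˡ-mod a≡b zero    = refl
  ^-congˡ-mod a≡b (suc k) = *-cong-mod a≡b (^-congˡ-mod a≡b k)

  sumFin-cong-mod : ∀ m {f g : Fin m → ℕ} → (∀ i → f i ≡ g i mod N) → sumFin m f ≡ sumFin m g mod N
  sumFin-cong-mod zero    f≈g = refl
  sumFin-cong-mod (suc m) f≈g = +-cong-mod (f≈g Fin.zero) (sumFin-cong-mod m (f≈g ∘ Fin.suc))

  prodFin-cong-mod : ∀ m {f g : Fin m → ℕ} → (∀ i → f i ≡ g i mod N) → prodFin m f ≡ prodFin m g mod N
  prodFin-cong-mod zero    f≈g = refl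
  prodFin-cong-mod (suc m) f≈g = *-cong-mod (f≈g Fin.zero) (prodFin-cong-mod m (f≈g ∘ Fin.suc))

  ∣⇒≡0-mod : ∀ {a} → N ∣ a → a ≡ 0 mod N
  ∣⇒≡0-mod {a} N∣a = trans (n∣m⇒m%n≡0 a N N∣a) (sym (n∣m⇒m%n≡0 0 N (N ∣0)))

  ≡0-mod⇒∣ : ∀ {a} → a ≡ 0 mod N → N ∣ a
  ≡0-mod⇒∣ {a} a≡0 = m%n≡0⇒n∣m a N (trans a≡0 (n∣m⇒m%n≡0 0 N (N ∣0)))

  +-≡-mod⇒∣ : ∀ a b → a + b ≡ a mod N → N ∣ b
  +-≡-mod⇒∣ a b a+b≡a = divides (q₁ ∸ q₂) (begin
    b                                         ≡⟨ m+n∸m≡n a b ⟨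
    (a + b) ∸ a                               ≡⟨ cong₂ _∸_ (m≡m%n+[m/n]*n (a + b) N) (m≡m%n+[m/n]*n a N) ⟩
    ((a + b) % N + q₁ * N) ∸ (a % N + q₂ * N) ≡⟨ cong (λ r → (r + q₁ * N) ∸ (a % N + q₂ * N)) a+b≡a ⟩
    (a % N + q₁ * N) ∸ (a % N + q₂ * N)       ≡⟨ [m+n]∸[m+o]≡n∸o (a % N) (q₁ * N) (q₂ * N) ⟩
    q₁ * N ∸ q₂ * N                           ≡⟨ *-distribʳ-∸ N q₁ q₂ ⟨
    (q₁ ∸ q₂) * N                             ∎)
    where
    open ≡-Reasoning
    q₁ = (a + b) / N
    q₂ = a / N

  x*c≡c⇒x≡1-mod : ∀ {c} → Coprime c N → ∀ x → x * c ≡ c mod N → x ≡ 1 mod N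
  x*c≡c⇒x≡1-mod c⊥N zero    0≡c = sym (∣⇒≡0-mod (∣-reflexive N≡1))
    where
    N≡1 : N ≡ 1
    N≡1 = c⊥N (≡0-mod⇒∣ (sym 0≡c) , ∣-refl)
  x*c≡c⇒x≡1-mod {c} c⊥N (suc z) c+zc≡c = %-remove-+ʳ 1 N∣z
    where
    N∣z : N ∣ z
    N∣z = coprime-divisor (Coprime.sym c⊥N) (subst (N ∣_) (*-comm z c) (+-≡-mod⇒∣ c (z * c) c+zc≡c))

  mod-inverse : ∀ {x} → Coprime x N → ∃ λ y → x * y ≡ 1 mod N
  mod-inverse {x} x⊥N with coprime-Bézout x⊥N
  ... | Bézout.+- a b 1+bN≡ax = a , (begin
    (x * a) % N      ≡⟨ cong (_% N) (trans (*-comm x a) (sym 1+bN≡ax)) ⟩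
    (1 + b * N) % N  ≡⟨ [m+kn]%n≡m%n 1 b N ⟩
    1 % N            ∎)
    where open ≡-Reasoning
  -- x a ≡ -1, so a (N - 1) inverts x
  ... | Bézout.-+ a b 1+ax≡bN = a * M , (begin
    (x * (a * M)) % N                 ≡⟨ %-remove-+ʳ (x * (a * M)) (n∣m*n b) ⟨
    (x * (a * M) + b * N) % N         ≡⟨ cong (λ t → (x * (a * M) + t) % N) 1+ax≡bN ⟨
    (x * (a * M) + (1 + a * x)) % N   ≡⟨ cong (_% N) regroup ⟩
    (1 + a * x * suc M) % N           ≡⟨ cong (λ t → (1 + a * x * t) % N) (suc-pred N) ⟩
    (1 + a * x * N) % N               ≡⟨ [m+kn]%n≡m%n 1 (a * x) N ⟩
    1 % N                             ∎)
    where
    open ≡-Reasoning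
    M = pred N
    regroup : x * (a * M) + (1 + a * x) ≡ 1 + a * x * suc M
    regroup = solve 3 (λ x a M → x :* (a :* M) :+ (con 1 :+ a :* x) := con 1 :+ a :* x :* (con 1 :+ M)) refl x a M
      where open +-*-Solver

-- Euler's theorem

module _ {N : ℕ} .{{_ : NonZero N}} where

  mulMod : ℕ → Fin N → Fin N
  mulMod c a = fromℕ< (m%n<n (c * toℕ a) N)

  mulMod-inverse : ∀ c d → c * d ≡ 1 mod N → ∀ a → mulMod d (mulMod c a) ≡ a
  mulMod-inverse c d cd≡1 a = toℕ-injective (begin
    toℕ (mulMod d (mulMod c a)) ≡⟨ toℕ-fromℕ< _ ⟩
    (d * toℕ (mulMod c a)) % N  ≡⟨ *-cong-mod {a = d} refl (trans (cong (_% N) (toℕ-fromℕ< _)) (m%n%n≡m%n _ N)) ⟩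
    (d * (c * toℕ a)) % N       ≡⟨ cong (_% N) (trans (sym (*-assoc d c (toℕ a))) (cong (_* toℕ a) (*-comm d c))) ⟩
    (c * d * toℕ a) % N         ≡⟨ *-cong-mod cd≡1 refl ⟩
    (1 * toℕ a) % N             ≡⟨ cong (_% N) (*-identityˡ (toℕ a)) ⟩
    toℕ a % N                   ≡⟨ m<n⇒m%n≡m (toℕ<n a) ⟩
    toℕ a                       ∎)
    where open ≡-Reasoning

  mulMod-permutation : ∀ c d → c * d ≡ 1 mod N → Permutation N N
  mulMod-permutation c d cd≡1 =
    permutation (mulMod c) (mulMod d) (mulMod-inverse d c dc≡1) (mulMod-inverse c d cd≡1)
    where
    dc≡1 : d * c ≡ 1 mod N
    dc≡1 = trans (cong (_% N) (*-comm d c)) cd≡1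

  unitPart : ℕ → ℕ
  unitPart a with coprime? a N
  ... | yes _ = a
  ... | no _  = 1

  unitPart-coprime : ∀ a → Coprime (unitPart a) N
  unitPart-coprime a with coprime? a N
  ... | yes a⊥N = a⊥N
  ... | no _    = 1-coprimeTo N

  unitPart-*-mod : ∀ {x} → Coprime x N → ∀ a → unitPart ((x * a) % N) ≡ x ^ 𝟙 (coprime? a N) * unitPart a mod N
  unitPart-*-mod {x} x⊥N a with coprime? a N | coprime? ((x * a) % N) N
  ... | yes _   | yes _ = trans (m%n%n≡m%n (x * a) N) (cong (λ t → (t * a) % N) (sym (*-identityʳ x)))
  ... | no _    | no _  = refl
  ... | yes a⊥N | no ¬r = ⊥-elim (¬r (Equivalence.from coprime-%⇔ (Equivalence.from (coprime-*ˡ⇔ x⊥N) a⊥N)))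
  ... | no ¬a   | yes r = ⊥-elim (¬a (Equivalence.to (coprime-*ˡ⇔ x⊥N) (Equivalence.to coprime-%⇔ r)))

-- Multiplication by x permutes the residues mod N and preserves the units among them, so it
-- multiplies their product P by x ^ (number of units); P is itself a unit and cancels.
euler : ∀ {N} .{{_ : NonZero N}} {x} → Coprime x N → x ^ φ N ≡ 1 mod N
euler {N} {x} x⊥N = subst (λ e → x ^ e ≡ 1 mod N) (sym (φ≡count-coprime N))
  (x*c≡c⇒x≡1-mod (prodFin-coprime N (unitPart ∘ toℕ) (unitPart-coprime ∘ toℕ)) (x ^ units) x^units*P≡P)
  where
  c : Fin N → ℕ
  c i = 𝟙 (coprime? (toℕ i) N)
  units = sumFin N c
  P = prodFin N (unitPart ∘ toℕ)
  π = mulMod-permutation x (proj₁ (mod-inverse x⊥N)) (proj₂ (mod-inverse x⊥N))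
  x^units*P≡P : x ^ units * P ≡ P mod N
  x^units*P≡P = begin
    (x ^ units * P) % N                                ≡⟨ cong (_% N) (prodFin-^-* x N c (unitPart ∘ toℕ)) ⟨
    prodFin N (λ i → x ^ c i * unitPart (toℕ i)) % N   ≡⟨ prodFin-cong-mod N permuted-factor ⟨
    prodFin N (λ i → unitPart (toℕ (mulMod x i))) % N  ≡⟨ cong (_% N) (prodFin-permute N (unitPart ∘ toℕ) π) ⟨
    P % N                                              ∎
    where
    open ≡-Reasoning
    permuted-factor : ∀ i → unitPart (toℕ (mulMod x i)) ≡ x ^ c i * unitPart (toℕ i) mod N
    permuted-factor i =
      trans (cong (λ t → unitPart t % N) (toℕ-fromℕ< (m%n<n (x * toℕ i) N))) (unitPart-*-mod x⊥N (toℕ i))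

-- Sums of n-th powers modulo a prime power

euler-∣ : ∀ {N n} .{{_ : NonZero N}} {z} → Coprime z N → φ N ∣ n → z ^ n ≡ 1 mod N
euler-∣ {N} {n} {z} z⊥N (divides t n≡tφ) = begin
  z ^ n % N          ≡⟨ cong (λ e → z ^ e % N) (trans n≡tφ (*-comm t (φ N))) ⟩
  z ^ (φ N * t) % N  ≡⟨ cong (_% N) (^-*-assoc z (φ N) t) ⟨
  (z ^ φ N) ^ t % N  ≡⟨ ^-congˡ-mod (euler z⊥N) t ⟩
  1 ^ t % N          ≡⟨ cong (_% N) (^-zeroˡ t) ⟩
  1 % N              ∎
  where open ≡-Reasoning

sumFin-^≡count-coprime-mod : ∀ {N n} .{{_ : NonZero N}} → φ N ∣ n → (∀ {z} → ¬ Coprime z N → N ∣ z ^ n) →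
  ∀ m (x : Fin m → ℕ) → sumFin m (λ i → x i ^ n) ≡ sumFin m (λ i → 𝟙 (coprime? (x i) N)) mod N
sumFin-^≡count-coprime-mod {N} {n} φ∣n nonunit-nilpotent m x = sumFin-cong-mod m residue
  where
  residue : ∀ i → x i ^ n ≡ 𝟙 (coprime? (x i) N) mod N
  residue i with coprime? (x i) N
  ... | yes x⊥N = euler-∣ x⊥N φ∣n
  ... | no ¬x⊥N = ∣⇒≡0-mod (nonunit-nilpotent ¬x⊥N)

p^[1+j]∣sumFin-^⇒p∣ : ∀ {p j n m} → Prime p → φ (p ^ suc j) ∣ n → suc j ≤ n → m < p ^ suc j →
  (x : Fin m → ℕ) → p ^ suc j ∣ sumFin m (λ i → x i ^ n) → ∀ i → p ∣ x i
p^[1+j]∣sumFin-^⇒p∣ {p} {j} {n} {m} pr φ∣n k≤n m<N x N∣Σ i =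
  ¬coprime[a,p^[1+j]]⇒∣ pr j (𝟙≡0⇒¬ (coprime? (x i) N) (sumFin≡0⇒≡0 m count-terms count≡0 i))
  where
  N = p ^ suc j
  instance
    N≢0 : NonZero N
    N≢0 = m^n≢0 p (suc j) {{prime⇒nonZero pr}}
  count-terms : Fin m → ℕ
  count-terms i = 𝟙 (coprime? (x i) N)
  nonunit-nilpotent : ∀ {z} → ¬ Coprime z N → N ∣ z ^ n
  nonunit-nilpotent ¬z⊥N = ∣-trans (^-monoʳ-∣ p k≤n) (∣⇒^∣^ (¬coprime[a,p^[1+j]]⇒∣ pr j ¬z⊥N) n)
  count<N : sumFin m count-terms < N
  count<N = ≤-<-trans (sumFin-≤1 m count-terms (λ i → 𝟙≤1 (coprime? (x i) N))) m<N
  count≡0 : sumFin m count-terms ≡ 0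
  count≡0 = begin
    sumFin m count-terms        ≡⟨ m<n⇒m%n≡m count<N ⟨
    sumFin m count-terms % N    ≡⟨ sumFin-^≡count-coprime-mod φ∣n nonunit-nilpotent m x ⟨
    sumFin m (λ i → x i ^ n) % N ≡⟨ ∣⇒≡0-mod N∣Σ ⟩
    0 % N                       ≡⟨ n∣m⇒m%n≡0 0 N (N ∣0) ⟩
    0                           ∎
    where open ≡-Reasoning

-- Cancelling the primes of c

Cancellable : ℕ → ℕ → ℕ → Set
Cancellable m n c = ∀ B → SolvableSumPow m n (B * c ^ n) → SolvableSumPow m n B

prime-cancellable : ∀ {p j n m} → Prime p → φ (p ^ suc j) ∣ n → suc j ≤ n → m < p ^ suc j →
  Cancellable m n p
prime-cancellable {p} {j} {n} {m} pr φ∣n k≤n m<N B (x , Σx^n≡Bp^n) =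
  y , *-cancelʳ-≡ _ B (p ^ n) Σy^n*p^n≡B*p^n
  where
  instance
    p≢0 : NonZero p
    p≢0 = prime⇒nonZero pr
    p^n≢0 : NonZero (p ^ n)
    p^n≢0 = m^n≢0 p n
  p∣x : ∀ i → p ∣ x i
  p∣x = p^[1+j]∣sumFin-^⇒p∣ pr φ∣n k≤n m<N x
    (subst (p ^ suc j ∣_) (sym Σx^n≡Bp^n) (∣n⇒∣m*n B (^-monoʳ-∣ p k≤n)))
  y : Fin m → ℕ
  y i = quotient (p∣x i)
  Σy^n*p^n≡B*p^n : sumFin m (λ i → y i ^ n) * p ^ n ≡ B * p ^ n
  Σy^n*p^n≡B*p^n = begin
    sumFin m (λ i → y i ^ n) * p ^ n     ≡⟨ sumFin-*ʳ m (λ i → y i ^ n) (p ^ n) ⟨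
    sumFin m (λ i → y i ^ n * p ^ n)     ≡⟨ sumFin-cong m (λ i → ^-distribʳ-* (y i) p n) ⟨
    sumFin m (λ i → (y i * p) ^ n)       ≡⟨ sumFin-cong m (λ i → cong (_^ n) (m∣n⇒n≡quotient*m (p∣x i))) ⟨
    sumFin m (λ i → x i ^ n)             ≡⟨ Σx^n≡Bp^n ⟩
    B * p ^ n                            ∎
    where open ≡-Reasoning

module _ {m n : ℕ} where

  cancellable-1 : Cancellable m n 1
  cancellable-1 B = subst (SolvableSumPow m n) (trans (cong (B *_) (^-zeroˡ n)) (*-identityʳ B))

  cancellable-* : ∀ {a b} → Cancellable m n a → Cancellable m n b → Cancellable m n (a * b)
  cancellable-* {a} {b} cancel-a cancel-b B = cancel-b B ∘ cancel-a (B * b ^ n) ∘ subst (SolvableSumPow m n) regroup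
    where
    open ≡-Reasoning
    regroup : B * (a * b) ^ n ≡ B * b ^ n * a ^ n
    regroup = begin
      B * (a * b) ^ n       ≡⟨ cong (B *_) (trans (^-distribʳ-* a b n) (*-comm (a ^ n) (b ^ n))) ⟩
      B * (b ^ n * a ^ n)   ≡⟨ *-assoc B (b ^ n) (a ^ n) ⟨
      B * b ^ n * a ^ n     ∎

  cancellable-^ : ∀ {a} → Cancellable m n a → ∀ e → Cancellable m n (a ^ e)
  cancellable-^ cancel-a zero    = cancellable-1
  cancellable-^ cancel-a (suc e) = cancellable-* cancel-a (cancellable-^ cancel-a e)

  cancellable-prodFin : ∀ l (c : Fin l → ℕ) → (∀ i → Cancellable m n (c i)) → Cancellable m n (prodFin l c)
  cancellable-prodFin zero    c cancel-c = cancellable-1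
  cancellable-prodFin (suc l) c cancel-c =
    cancellable-* (cancel-c Fin.zero) (cancellable-prodFin l (c ∘ Fin.suc) (cancel-c ∘ Fin.suc))

  solvable-scale : ∀ {b} c → SolvableSumPow m n b → SolvableSumPow m n (b * c ^ n)
  solvable-scale {b} c (x , Σx^n≡b) = (λ i → x i * c) , (begin
    sumFin m (λ i → (x i * c) ^ n)    ≡⟨ sumFin-cong m (λ i → ^-distribʳ-* (x i) c n) ⟩
    sumFin m (λ i → x i ^ n * c ^ n)  ≡⟨ sumFin-*ʳ m (λ i → x i ^ n) (c ^ n) ⟩
    sumFin m (λ i → x i ^ n) * c ^ n  ≡⟨ cong (_* c ^ n) Σx^n≡b ⟩
    b * c ^ n                         ∎)
    where open ≡-Reasoning

≤∸1⇒< : ∀ {m n} → 1 ≤ n → m ≤ n ∸ 1 → m < n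
≤∸1⇒< {n = suc n} _ m≤n = s≤s m≤n

theorem8 : (n : ℕ) → n ≥ 2 → 2 ∣ n →
    (l : ℕ) (p k : Fin l → ℕ) →
    Injective _≡_ _≡_ p →
    (∀ i → IsφDivisorOfDegree n (p i) (k i)) →
    (m : ℕ) → 2 ≤ m → (∀ i → m ≤ p i ^ k i ∸ 1) →
    (e : Fin l → ℕ) (b : ℕ) →
    SolvableSumPow m n (b * prodFin l (λ i → p i ^ e i) ^ n) ⇔ SolvableSumPow m n b
theorem8 n n≥2 _ l p k _ φ-divisor m _ m≤p^k∸1 e b =
  mk⇔ (cancellable-prodFin {m} {n} l (λ i → p i ^ e i) cancel-p^e b) (solvable-scale {m} {n} c)
  where
  c = prodFin l (λ i → p i ^ e i)
  instance
    n≢0 : NonZero n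
    n≢0 = >-nonZero (≤-trans (s≤s z≤n) n≥2)
  φ-divisor⇒cancellable : ∀ {q k} → IsφDivisorOfDegree n q k → m ≤ q ^ k ∸ 1 → Cancellable m n q
  φ-divisor⇒cancellable {k = zero}  (_ , s≤s () , _)
  φ-divisor⇒cancellable {k = suc j} (q-prime , q^k≥3 , φ∣n , _) m≤q^k∸1 =
    prime-cancellable q-prime φ∣n (≤-trans (k≤φ[p^k] q-prime (suc j)) (∣⇒≤ φ∣n))
      (≤∸1⇒< (≤-trans (s≤s z≤n) q^k≥3) m≤q^k∸1)
  cancel-p^e : ∀ i → Cancellable m n (p i ^ e i)
  cancel-p^e i = cancellable-^ {m} {n} (φ-divisor⇒cancellable (φ-divisor i) (m≤p^k∸1 i)) (e i)
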